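{- Let $n, r, k, j$ be integers with $n \geq r+1$ and $r+1 \geq k \geq 7$, and let $U$ be a graph on $k$ vertices with $j$ edges which contains neither a cycle on $4$ vertices nor $Z_4$ as a subgraph. Then $$\sigma(K_{r+1} - U, n) \geq \begin{cases} (r-1)(2n-r) - 3(n-r) - 1, & \text{if } n-r \text{ is odd},\\ (r-1)(2n-r) - 3(n-r), & \text{if } n-r \text{ is even}.\end{cases}$$
   Context: All graphs are finite and simple. A non-increasing sequence $\pi=(d_1,\dots,d_n)$ of nonnegative integers is graphic if it is the degree sequence of a simple graph on $n$ vertices (a realization of $\pi$); $\sigma(\pi)=d_1+\dots+d_n$. For a graph $H$, $\pi$ is potentially $H$-graphic if some realization of $\pi$ contains $H$ as a (not necessarily induced) subgraph. $\sigma(H,n)$ denotes the minimum even integer $l$ such that every $n$-term graphic sequence $\pi$ with $\sigma(\pi)\geq l$ is potentially $H$-graphic. $K_m$ is the complete graph on $m$ vertices; for a subgraph $H$ of $K_m$, $K_m - H$ is the graph obtained from $K_m$ by deleting the edges of $H$ (here $U$ is regarded as a subgraph of $K_{r+1}$). $Z_4$ denotes $K_4 - P_2$, where $P_2$ is the path with $2$ edges, i.e. a triangle with a pendant edge attached. -}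

module Defs where

open import Data.Bool using (Bool; true; false; not; _∧_; if_then_else_)
open import Data.Nat using (ℕ; zero; suc; _+_; _*_; _∸_; _≤_; _<?_; _%_)
open import Data.Nat.Divisibility using (_∣_)
open import Data.Fin using (Fin; toℕ; fromℕ<; _≟_)
import Data.Fin as F
open import Data.List using (List; map; allFin; concatMap)
open import Data.Nat.ListAction using (sum)
open import Data.Product using (Σ; _×_; _,_)
open import Relation.Binary.PropositionalEquality using (_≡_; refl; sym)
open import Relation.Nullary using (yes; no; ¬_)
open import Relation.Nullary.Decidable using (⌊_⌋)
open import Function.Definitions using (Injective)
open import Data.Integer as ℤ using (ℤ; +_)

record Graph (n : ℕ) : Set where
  field
    adj    : Fin n → Fin n → Bool
    adj-sym : ∀ a b → adj a b ≡ adj b a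
    irrefl : ∀ a → adj a a ≡ false
open Graph public

deg : ∀ {n} → Graph n → Fin n → ℕ
deg {n} G v = sum (map (λ w → if adj G v w then 1 else 0) (allFin n))

edgeCount : ∀ {n} → Graph n → ℕ
edgeCount {n} G =
  sum (concatMap (λ a → map (λ b → if ⌊ toℕ a <? toℕ b ⌋ ∧ adj G a b then 1 else 0)
                            (allFin n))
                 (allFin n))

_⊆ᵍ_ : ∀ {m n} → Graph m → Graph n → Set
_⊆ᵍ_ {m} {n} H G =
  Σ (Fin m → Fin n) λ f → Injective _≡_ _≡_ f ×
    (∀ a b → adj H a b ≡ true → adj G (f a) (f b) ≡ true)

private
  c4 : Fin 4 → Fin 4 → Bool
  c4 F.zero (F.suc F.zero) = true
  c4 (F.suc F.zero) F.zero = true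
  c4 (F.suc F.zero) (F.suc (F.suc F.zero)) = true
  c4 (F.suc (F.suc F.zero)) (F.suc F.zero) = true
  c4 (F.suc (F.suc F.zero)) (F.suc (F.suc (F.suc F.zero))) = true
  c4 (F.suc (F.suc (F.suc F.zero))) (F.suc (F.suc F.zero)) = true
  c4 (F.suc (F.suc (F.suc F.zero))) F.zero = true
  c4 F.zero (F.suc (F.suc (F.suc F.zero))) = true
  c4 _ _ = false

  c4-sym : ∀ a b → c4 a b ≡ c4 b a
  c4-sym F.zero F.zero = refl
  c4-sym F.zero (F.suc F.zero) = refl
  c4-sym F.zero (F.suc (F.suc F.zero)) = refl
  c4-sym F.zero (F.suc (F.suc (F.suc F.zero))) = refl
  c4-sym (F.suc F.zero) F.zero = refl
  c4-sym (F.suc F.zero) (F.suc F.zero) = refl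
  c4-sym (F.suc F.zero) (F.suc (F.suc F.zero)) = refl
  c4-sym (F.suc F.zero) (F.suc (F.suc (F.suc F.zero))) = refl
  c4-sym (F.suc (F.suc F.zero)) F.zero = refl
  c4-sym (F.suc (F.suc F.zero)) (F.suc F.zero) = refl
  c4-sym (F.suc (F.suc F.zero)) (F.suc (F.suc F.zero)) = refl
  c4-sym (F.suc (F.suc F.zero)) (F.suc (F.suc (F.suc F.zero))) = refl
  c4-sym (F.suc (F.suc (F.suc F.zero))) F.zero = refl
  c4-sym (F.suc (F.suc (F.suc F.zero))) (F.suc F.zero) = refl
  c4-sym (F.suc (F.suc (F.suc F.zero))) (F.suc (F.suc F.zero)) = refl
  c4-sym (F.suc (F.suc (F.suc F.zero))) (F.suc (F.suc (F.suc F.zero))) = refl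

  c4-irr : ∀ a → c4 a a ≡ false
  c4-irr F.zero = refl
  c4-irr (F.suc F.zero) = refl
  c4-irr (F.suc (F.suc F.zero)) = refl
  c4-irr (F.suc (F.suc (F.suc F.zero))) = refl

  -- Z4 = K4 - P2 : triangle 0,1,2 plus pendant edge 2-3
  z4 : Fin 4 → Fin 4 → Bool
  z4 F.zero (F.suc F.zero) = true
  z4 (F.suc F.zero) F.zero = true
  z4 F.zero (F.suc (F.suc F.zero)) = true
  z4 (F.suc (F.suc F.zero)) F.zero = true
  z4 (F.suc F.zero) (F.suc (F.suc F.zero)) = true
  z4 (F.suc (F.suc F.zero)) (F.suc F.zero) = true
  z4 (F.suc (F.suc F.zero)) (F.suc (F.suc (F.suc F.zero))) = true
  z4 (F.suc (F.suc (F.suc F.zero))) (F.suc (F.suc F.zero)) = true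
  z4 _ _ = false

  z4-sym : ∀ a b → z4 a b ≡ z4 b a
  z4-sym F.zero F.zero = refl
  z4-sym F.zero (F.suc F.zero) = refl
  z4-sym F.zero (F.suc (F.suc F.zero)) = refl
  z4-sym F.zero (F.suc (F.suc (F.suc F.zero))) = refl
  z4-sym (F.suc F.zero) F.zero = refl
  z4-sym (F.suc F.zero) (F.suc F.zero) = refl
  z4-sym (F.suc F.zero) (F.suc (F.suc F.zero)) = refl
  z4-sym (F.suc F.zero) (F.suc (F.suc (F.suc F.zero))) = refl
  z4-sym (F.suc (F.suc F.zero)) F.zero = refl
  z4-sym (F.suc (F.suc F.zero)) (F.suc F.zero) = refl
  z4-sym (F.suc (F.suc F.zero)) (F.suc (F.suc F.zero)) = refl
  z4-sym (F.suc (F.suc F.zero)) (F.suc (F.suc (F.suc F.zero))) = refl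
  z4-sym (F.suc (F.suc (F.suc F.zero))) F.zero = refl
  z4-sym (F.suc (F.suc (F.suc F.zero))) (F.suc F.zero) = refl
  z4-sym (F.suc (F.suc (F.suc F.zero))) (F.suc (F.suc F.zero)) = refl
  z4-sym (F.suc (F.suc (F.suc F.zero))) (F.suc (F.suc (F.suc F.zero))) = refl

  z4-irr : ∀ a → z4 a a ≡ false
  z4-irr F.zero = refl
  z4-irr (F.suc F.zero) = refl
  z4-irr (F.suc (F.suc F.zero)) = refl
  z4-irr (F.suc (F.suc (F.suc F.zero))) = refl

C4 : Graph 4
C4 = record { adj = c4 ; adj-sym = c4-sym ; irrefl = c4-irr }

Z4 : Graph 4
Z4 = record { adj = z4 ; adj-sym = z4-sym ; irrefl = z4-irr }

-- K_{r+1} - U, where U (on k vertices) is regarded as a subgraph of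
-- K_{r+1} on the first k vertices 0,…,k-1 of Fin (r+1).

private
  liftAdj : ∀ {k} (U : Graph k) (m : ℕ) → Fin m → Fin m → Bool
  liftAdj {k} U m a b with toℕ a <? k | toℕ b <? k
  ... | yes p | yes q = adj U (fromℕ< p) (fromℕ< q)
  ... | yes _ | no _  = false
  ... | no _  | yes _ = false
  ... | no _  | no _  = false

  liftAdj-sym : ∀ {k} (U : Graph k) m a b → liftAdj U m a b ≡ liftAdj U m b a
  liftAdj-sym {k} U m a b with toℕ a <? k | toℕ b <? k
  ... | yes p | yes q = Graph.adj-sym U (fromℕ< p) (fromℕ< q)
  ... | yes _ | no _  = refl
  ... | no _  | yes _ = refl
  ... | no _  | no _  = refl

  eqb : ∀ {m} → Fin m → Fin m → Bool
  eqb a b = ⌊ a ≟ b ⌋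

  eqb-sym : ∀ {m} (a b : Fin m) → eqb a b ≡ eqb b a
  eqb-sym a b with a ≟ b | b ≟ a
  ... | yes _ | yes _ = refl
  ... | no _  | no _  = refl
  ... | yes e | no ne = Data.Empty.⊥-elim (ne (sym e))
    where import Data.Empty
  ... | no ne | yes e = Data.Empty.⊥-elim (ne (sym e))
    where import Data.Empty

  eqb-refl : ∀ {m} (a : Fin m) → eqb a a ≡ true
  eqb-refl a with a ≟ a
  ... | yes _ = refl
  ... | no ne = Data.Empty.⊥-elim (ne refl)
    where import Data.Empty

  kAdj : ∀ {k} (U : Graph k) (m : ℕ) → Fin m → Fin m → Bool
  kAdj U m a b = not (eqb a b) ∧ not (liftAdj U m a b)

  kAdj-sym : ∀ {k} (U : Graph k) m a b → kAdj U m a b ≡ kAdj U m b a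
  kAdj-sym U m a b rewrite eqb-sym a b | liftAdj-sym U m a b = refl

  kAdj-irr : ∀ {k} (U : Graph k) m a → kAdj U m a a ≡ false
  kAdj-irr U m a rewrite eqb-refl a = refl

KminusU : ∀ {k} (r : ℕ) → Graph k → Graph (suc r)
KminusU r U = record { adj = kAdj U (suc r) ; adj-sym = kAdj-sym U (suc r) ; irrefl = kAdj-irr U (suc r) }

Seq : ℕ → Set
Seq n = Fin n → ℕ

NonIncreasing : ∀ {n} → Seq n → Set
NonIncreasing π = ∀ a b → a F.≤ b → π b ≤ π a

σ : ∀ {n} → Seq n → ℕ
σ {n} π = sum (map π (allFin n))

Realizes : ∀ {n} → Graph n → Seq n → Set
Realizes G π = ∀ v → deg G v ≡ π v

Graphic : ∀ {n} → Seq n → Set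
Graphic {n} π = NonIncreasing π × Σ (Graph n) λ G → Realizes G π

PotentiallyGraphic : ∀ {m n} → Graph m → Seq n → Set
PotentiallyGraphic {m} {n} H π = Σ (Graph n) λ G → Realizes G π × (H ⊆ᵍ G)

-- l is an admissible value in the definition of σ(H,n):
-- l is even and every n-term graphic sequence with σ(π) ≥ l is potentially H-graphic.
-- σ(H,n) is the minimum such l; "σ(H,n) ≥ B" is stated as: every admissible l is ≥ B.
SigmaAdmissible : ∀ {m} → Graph m → ℕ → ℕ → Set
SigmaAdmissible H n l =
  (2 ∣ l) × (∀ (π : Seq n) → Graphic π → l ≤ σ π → PotentiallyGraphic H π)

bound : ℕ → ℕ → ℤ
bound n r with (n ∸ r) % 2
... | 1 = (+ r ℤ.- + 1) ℤ.* (+ 2 ℤ.* + n ℤ.- + r) ℤ.- + 3 ℤ.* (+ n ℤ.- + r) ℤ.- + 1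
... | _ = (+ r ℤ.- + 1) ℤ.* (+ 2 ℤ.* + n ℤ.- + r) ℤ.- + 3 ℤ.* (+ n ℤ.- + r)

-- Put t = r − 3 and m = n − t ≥ 4, and let π be the degree sequence of the join K_t ∨ L, where L
-- is a perfect matching on m vertices if m is even, and a matching plus a path with two edges if m is
-- odd; so π = ((n − 1)^t, t + 1 + [m odd], (t + 1)^(m − 1)) and σ(π) + 2 is the claimed bound.
-- In a realization G of π the first t vertices have degree n − 1, so they are adjacent to everything.
-- An embedding of K_{r+1} − U into G sends at least 4 of its r + 1 = t + 4 vertices outside them;
-- among these 4 images, G induces a graph of maximum degree 2 in which at most one vertex (the one
-- of degree t + 1 + [m odd] in G) has degree 2, and the complement of such a graph contains C4 or Z4.
-- The 4 vertices lie in U, since a vertex outside U is adjacent to all others in K_{r+1} − U, and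
-- non-adjacent pairs of images come from edges of U; so U would contain C4 or Z4. Hence π is not
-- potentially (K_{r+1} − U)-graphic, and as σ(π) and every admissible l are even, l ≥ σ(π) + 2.

module Submission where

open import Data.Bool using (Bool; true; false; not; _∧_; _∨_; if_then_else_)
import Data.Bool.Properties as Boolₚ
open import Data.Bool.Properties using (∧-inverseˡ; ∨-inverseˡ; ∧-identityʳ; ∧-zeroʳ; ∨-identityʳ)
open import Data.Fin as Fin using (Fin; zero; suc; toℕ; fromℕ<; punchIn; _↑ˡ_; _↑ʳ_; splitAt)
import Data.Fin.Properties as Finₚ
open import Data.Integer as ℤ using (ℤ; +_; +≤+) renaming (_≤_ to _≤ℤ_)
import Data.Integer.Properties as ℤₚ
import Data.Integer.Tactic.RingSolver as ℤ-Solver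
open import Data.List using ([]; _∷_; tabulate)
open import Data.List.Properties using (map-tabulate)
open import Data.Nat
open import Data.Nat.DivMod using (_%_; m%n<n; [m+kn]%n≡m%n)
open import Data.Nat.Divisibility using (_∣_; divides)
open import Data.Nat.ListAction using (sum)
open import Data.Nat.Properties
import Data.Nat.Tactic.RingSolver as ℕ-Solver
open import Data.Product using (Σ; ∃; ∃₂; _×_; _,_; proj₁; proj₂)
open import Data.Sum as Sum using (_⊎_; inj₁; inj₂)
open import Function using (_∘_; id)
open import Function.Bundles using (_⇔_; mk⇔)
open import Function.Definitions using (Injective)
open import Level using (Level)
open import Relation.Binary.Definitions using (tri<; tri≈; tri>)
open import Relation.Binary.PropositionalEquality
open import Relation.Nullary using (Dec; ¬_; yes; no; ¬?; contradiction)
open import Relation.Nullary.Decidable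
  using (⌊_⌋; isYes≗does; dec-true; dec-false; does-⇔; _×-dec_; _⊎-dec_; _→-dec_; from-yes)
open import Relation.Unary using (Decidable)
open import Defs

open import Algebra.Properties.CommutativeSemigroup +-commutativeSemigroup using (interchange)

private
  variable
    a : Level
    A B : Set a
    k m n : ℕ
    p q : Fin n → Bool

⌊⌋-⇔ : A ⇔ B → (a? : Dec A) (b? : Dec B) → ⌊ a? ⌋ ≡ ⌊ b? ⌋
⌊⌋-⇔ A⇔B a? b? = trans (isYes≗does a?) (trans (does-⇔ A⇔B a? b?) (sym (isYes≗does b?)))

⌊⌋-true : (a? : Dec A) → A → ⌊ a? ⌋ ≡ true
⌊⌋-true a? a = trans (isYes≗does a?) (dec-true a? a)

⌊⌋-false : (a? : Dec A) → ¬ A → ⌊ a? ⌋ ≡ false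
⌊⌋-false a? ¬a = trans (isYes≗does a?) (dec-false a? ¬a)

σ≡sum-tabulate : (f : Fin n → ℕ) → σ f ≡ sum (tabulate f)
σ≡sum-tabulate f = cong sum (map-tabulate id f)

σ-suc : (f : Fin (suc n) → ℕ) → σ f ≡ f zero + σ (f ∘ suc)
σ-suc f = trans (σ≡sum-tabulate f) (cong (_+_ (f zero)) (sym (σ≡sum-tabulate (f ∘ suc))))

σ-cong : {f g : Fin n → ℕ} → (∀ x → f x ≡ g x) → σ f ≡ σ g
σ-cong {zero}  f≗g = refl
σ-cong {suc n} {f} {g} f≗g = begin
  σ f                  ≡⟨ σ-suc f ⟩
  f zero + σ (f ∘ suc) ≡⟨ cong₂ _+_ (f≗g zero) (σ-cong (f≗g ∘ suc)) ⟩
  g zero + σ (g ∘ suc) ≡⟨ σ-suc g ⟨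
  σ g                  ∎
  where open ≡-Reasoning

σ-+ : (f g : Fin n → ℕ) → σ (λ x → f x + g x) ≡ σ f + σ g
σ-+ {zero}  f g = refl
σ-+ {suc n} f g = begin
  σ (λ x → f x + g x)                                  ≡⟨ σ-suc (λ x → f x + g x) ⟩
  (f zero + g zero) + σ (λ x → f (suc x) + g (suc x))  ≡⟨ cong (_+_ (f zero + g zero)) (σ-+ (f ∘ suc) (g ∘ suc)) ⟩
  (f zero + g zero) + (σ (f ∘ suc) + σ (g ∘ suc))      ≡⟨ interchange (f zero) (g zero) _ _ ⟩
  (f zero + σ (f ∘ suc)) + (g zero + σ (g ∘ suc))      ≡⟨ cong₂ _+_ (σ-suc f) (σ-suc g) ⟨
  σ f + σ g                                            ∎
  where open ≡-Reasoning

σ-mono : {f g : Fin n → ℕ} → (∀ x → f x ≤ g x) → σ f ≤ σ g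
σ-mono {zero}  f≤g = z≤n
σ-mono {suc n} {f} {g} f≤g = begin
  σ f                  ≡⟨ σ-suc f ⟩
  f zero + σ (f ∘ suc) ≤⟨ +-mono-≤ (f≤g zero) (σ-mono (f≤g ∘ suc)) ⟩
  g zero + σ (g ∘ suc) ≡⟨ σ-suc g ⟨
  σ g                  ∎
  where open ≤-Reasoning

σ-const : ∀ n c → σ {n} (λ _ → c) ≡ n * c
σ-const zero    c = refl
σ-const (suc n) c = trans (σ-suc {n} (λ _ → c)) (cong (_+_ c) (σ-const n c))

σ-↑ : ∀ t {m} (f : Fin (t + m) → ℕ) → σ f ≡ σ (λ i → f (i ↑ˡ m)) + σ (λ a → f (t ↑ʳ a))
σ-↑ zero    f = refl
σ-↑ (suc t) {m} f = begin
  σ f                                  ≡⟨ σ-suc f ⟩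
  f zero + σ (f ∘ suc)                 ≡⟨ cong (_+_ (f zero)) (σ-↑ t (f ∘ suc)) ⟩
  f zero + (σ (left ∘ suc) + σ right)  ≡⟨ +-assoc (f zero) _ _ ⟨
  (f zero + σ (left ∘ suc)) + σ right  ≡⟨ cong (_+ σ right) (σ-suc left) ⟨
  σ left + σ right                     ∎
  where
  open ≡-Reasoning
  left : Fin (suc t) → ℕ
  left i = f (i ↑ˡ m)
  right : Fin m → ℕ
  right a = f (suc t ↑ʳ a)

σ-swap : (f : Fin m → Fin n → ℕ) → σ (λ u → σ (f u)) ≡ σ (λ w → σ (λ u → f u w))
σ-swap {zero} {n} f = sym (trans (σ-const n 0) (*-zeroʳ n))
σ-swap {suc m} f = begin
  σ (λ u → σ (f u))                                   ≡⟨ σ-suc (λ u → σ (f u)) ⟩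
  σ (f zero) + σ (λ u → σ (f (suc u)))                ≡⟨ cong (_+_ (σ (f zero))) (σ-swap (f ∘ suc)) ⟩
  σ (f zero) + σ (λ w → σ (λ u → f (suc u) w))        ≡⟨ σ-+ (f zero) _ ⟨
  σ (λ w → f zero w + σ (λ u → f (suc u) w))          ≡⟨ σ-cong (λ w → σ-suc (λ u → f u w)) ⟨
  σ (λ w → σ (λ u → f u w))                           ∎
  where open ≡-Reasoning

𝟙 : Bool → ℕ
𝟙 b = if b then 1 else 0

𝟙≤1 : ∀ b → 𝟙 b ≤ 1
𝟙≤1 false = z≤n
𝟙≤1 true  = s≤s z≤n

-- Opaque, so that unification sees count p instead of an unfolded list sum.
opaque
  count : (Fin n → Bool) → ℕ
  count p = σ (λ x → 𝟙 (p x))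

opaque
  unfolding count

  deg≡count : (G : Graph n) (u : Fin n) → deg G u ≡ count (adj G u)
  deg≡count G u = refl

  count-suc : (p : Fin (suc n) → Bool) → count p ≡ 𝟙 (p zero) + count (p ∘ suc)
  count-suc p = σ-suc (λ x → 𝟙 (p x))

  count-cong : (∀ x → p x ≡ q x) → count p ≡ count q
  count-cong p≗q = σ-cong (λ x → cong 𝟙 (p≗q x))

  count-mono : (∀ x → p x ≡ true → q x ≡ true) → count p ≤ count q
  count-mono {p = p} {q} p⊆q = σ-mono pointwise
    where
    pointwise : ∀ x → 𝟙 (p x) ≤ 𝟙 (q x)
    pointwise x with p x in px
    ... | false = z≤n
    ... | true  rewrite p⊆q x px = ≤-refl

  count-∨ : (∀ x → (p x ∧ q x) ≡ false) → count (λ x → p x ∨ q x) ≡ count p + count q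
  count-∨ {p = p} {q} disjoint = trans (σ-cong pointwise) (σ-+ (λ x → 𝟙 (p x)) (λ x → 𝟙 (q x)))
    where
    pointwise : ∀ x → 𝟙 (p x ∨ q x) ≡ 𝟙 (p x) + 𝟙 (q x)
    pointwise x with p x | q x | disjoint x
    ... | false | _     | _ = refl
    ... | true  | false | _ = refl

  count≡σ : (p : Fin n → Bool) → count p ≡ σ (λ x → 𝟙 (p x))
  count≡σ p = refl

  count-empty : (p : Fin 0 → Bool) → count p ≡ 0
  count-empty p = refl

  count-↑ : ∀ t {m} (p : Fin (t + m) → Bool) → count p ≡ count (λ i → p (i ↑ˡ m)) + count (λ a → p (t ↑ʳ a))
  count-↑ t p = σ-↑ t (λ x → 𝟙 (p x))

  count-const : ∀ n b → count {n} (λ _ → b) ≡ n * 𝟙 b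
  count-const n b = σ-const n (𝟙 b)

count-true : ∀ n → count {n} (λ _ → true) ≡ n
count-true n = trans (count-const n true) (*-identityʳ n)

count-false : ∀ n → count {n} (λ _ → false) ≡ 0
count-false n = trans (count-const n false) (*-zeroʳ n)

count-≡ : (w : Fin n) → count (λ x → ⌊ x Fin.≟ w ⌋) ≡ 1
count-≡ {suc n} zero = trans (count-suc {n} (λ x → ⌊ x Fin.≟ zero ⌋)) (cong suc (count-false n))
count-≡ {suc n} (suc w) = begin
  count (λ x → ⌊ x Fin.≟ suc w ⌋)      ≡⟨ count-suc {n} (λ x → ⌊ x Fin.≟ suc w ⌋) ⟩
  count (λ x → ⌊ suc x Fin.≟ suc w ⌋)  ≡⟨ count-cong {p = λ x → ⌊ suc x Fin.≟ suc w ⌋} peel ⟩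
  count (λ x → ⌊ x Fin.≟ w ⌋)          ≡⟨ count-≡ w ⟩
  1                                    ∎
  where
  open ≡-Reasoning
  peel : ∀ x → ⌊ suc x Fin.≟ suc w ⌋ ≡ ⌊ x Fin.≟ w ⌋
  peel x = ⌊⌋-⇔ (mk⇔ Finₚ.suc-injective (cong suc)) (suc x Fin.≟ suc w) (x Fin.≟ w)

count-not : (p : Fin n → Bool) → count (λ x → not (p x)) + count p ≡ n
count-not {n} p = begin
  count (λ x → not (p x)) + count p   ≡⟨ count-∨ (λ x → ∧-inverseˡ (p x)) ⟨
  count (λ x → not (p x) ∨ p x)       ≡⟨ count-cong (λ x → ∨-inverseˡ (p x)) ⟩
  count {n} (λ _ → true)              ≡⟨ count-true n ⟩
  n                                   ∎
  where open ≡-Reasoning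

count-≢ : (w : Fin n) → count (λ x → not ⌊ x Fin.≟ w ⌋) ≡ n ∸ 1
count-≢ {n} w = begin
  count (λ x → not (≟w x))            ≡⟨ m+n∸n≡m _ 1 ⟨
  count (λ x → not (≟w x)) + 1 ∸ 1    ≡⟨ cong (λ c → count (λ x → not (≟w x)) + c ∸ 1) (count-≡ w) ⟨
  count (λ x → not (≟w x)) + count ≟w ∸ 1 ≡⟨ cong (_∸ 1) (count-not ≟w) ⟩
  n ∸ 1                               ∎
  where
  open ≡-Reasoning
  ≟w : Fin n → Bool
  ≟w x = ⌊ x Fin.≟ w ⌋

count-∧-≡ : ∀ b (w : Fin n) → count (λ x → b ∧ ⌊ x Fin.≟ w ⌋) ≡ 𝟙 b
count-∧-≡ {n} false w = count-false n
count-∧-≡ true  w = count-≡ w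

count-< : ∀ {t n} → t ≤ n → count {n} (λ x → ⌊ toℕ x <? t ⌋) ≡ t
count-< {zero}  {n} z≤n = count-false n
count-< {suc t} {suc n} (s≤s t≤n) = begin
  count (λ (x : Fin (suc n)) → ⌊ toℕ x <? suc t ⌋)       ≡⟨ count-suc {n} (λ x → ⌊ toℕ x <? suc t ⌋) ⟩
  suc (count (λ (x : Fin n) → ⌊ suc (toℕ x) <? suc t ⌋))  ≡⟨ cong suc (count-cong peel) ⟩
  suc (count (λ (x : Fin n) → ⌊ toℕ x <? t ⌋))            ≡⟨ cong suc (count-< t≤n) ⟩
  suc t                                                   ∎
  where
  open ≡-Reasoning
  peel : ∀ (x : Fin n) → ⌊ suc (toℕ x) <? suc t ⌋ ≡ ⌊ toℕ x <? t ⌋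
  peel x = ⌊⌋-⇔ (mk⇔ s<s⁻¹ s<s) (suc (toℕ x) <? suc t) (toℕ x <? t)

count-∘-injective : (v : Fin m → Fin n) → Injective _≡_ _≡_ v →
                    (p : Fin n → Bool) → count (p ∘ v) ≤ count p
count-∘-injective {zero}  v v-inj p = ≤-trans (≤-reflexive (count-empty (p ∘ v))) z≤n
count-∘-injective {suc m} {n} v v-inj p = begin
  count (p ∘ v)                                    ≡⟨ count-suc (p ∘ v) ⟩
  𝟙 (p w) + count (p ∘ v ∘ suc)
    ≡⟨ cong (_+_ (𝟙 (p w))) (count-cong (λ j → p-off-w (v (suc j)) (w≢ j))) ⟩
  𝟙 (p w) + count (p-off ∘ v ∘ suc)
    ≤⟨ +-monoʳ-≤ (𝟙 (p w)) (count-∘-injective (v ∘ suc) (Finₚ.suc-injective ∘ v-inj) p-off) ⟩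
  𝟙 (p w) + count p-off                            ≡⟨ cong (_+ count p-off) (count-∧-≡ (p w) w) ⟨
  count (λ x → p w ∧ ⌊ x Fin.≟ w ⌋) + count p-off  ≡⟨ count-∨ (λ x → at-w-disjoint x) ⟨
  count (λ x → (p w ∧ ⌊ x Fin.≟ w ⌋) ∨ p-off x)    ≡⟨ count-cong split ⟩
  count p                                          ∎
  where
  open ≤-Reasoning
  w : Fin n
  w = v zero
  p-off : Fin n → Bool
  p-off x = p x ∧ not ⌊ x Fin.≟ w ⌋
  w≢ : ∀ j → v (suc j) ≢ w
  w≢ j eq = Finₚ.0≢1+n (sym (v-inj eq))
  p-off-w : ∀ x → x ≢ w → p x ≡ p-off x
  p-off-w x x≢w rewrite ⌊⌋-false (x Fin.≟ w) x≢w = sym (∧-identityʳ (p x))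
  at-w-disjoint : ∀ x → ((p w ∧ ⌊ x Fin.≟ w ⌋) ∧ p-off x) ≡ false
  at-w-disjoint x with x Fin.≟ w
  ... | yes refl rewrite ∧-zeroʳ (p w) = ∧-zeroʳ _
  ... | no  _    rewrite ∧-zeroʳ (p w) = refl
  split : ∀ x → ((p w ∧ ⌊ x Fin.≟ w ⌋) ∨ p-off x) ≡ p x
  split x with x Fin.≟ w
  ... | yes refl rewrite ∧-identityʳ (p w) | ∧-zeroʳ (p w) = ∨-identityʳ (p w)
  ... | no  _    rewrite ∧-zeroʳ (p w) = ∧-identityʳ (p x)

degree-sum-even : (G : Graph n) → 2 ∣ σ (deg G)
degree-sum-even {n} G = divides X (begin
  σ (deg G)                                                   ≡⟨ σ-cong (λ u → trans (deg≡count G u) (count-cong (split u))) ⟩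
  σ (λ u → count (λ w → forward u w ∨ forward w u))          ≡⟨ σ-cong (λ u → count-∨ (disjoint u)) ⟩
  σ (λ u → count (forward u) + count (λ w → forward w u))    ≡⟨ σ-+ (λ u → count (forward u)) _ ⟩
  X + σ (λ u → count (λ w → forward w u))                     ≡⟨ cong (_+_ X) backward≡forward ⟩
  X + X                                                       ≡⟨ cong (_+_ X) (*-identityʳ X) ⟨
  X + X * 1                                                   ≡⟨ *-suc X 1 ⟨
  X * 2                                                       ∎)
  where
  open ≡-Reasoning
  forward : Fin n → Fin n → Bool
  forward u w = ⌊ u Finₚ.<? w ⌋ ∧ adj G u w
  X : ℕ
  X = σ (λ u → count (forward u))
  split : ∀ u w → adj G u w ≡ (forward u w ∨ forward w u)
  split u w with Finₚ.<-cmp u w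
  ... | tri< u<w _ w≮u rewrite ⌊⌋-true (u Finₚ.<? w) u<w | ⌊⌋-false (w Finₚ.<? u) w≮u = sym (∨-identityʳ _)
  ... | tri≈ u≮u refl _ rewrite ⌊⌋-false (u Finₚ.<? u) u≮u = irrefl G u
  ... | tri> u≮w _ w<u rewrite ⌊⌋-false (u Finₚ.<? w) u≮w | ⌊⌋-true (w Finₚ.<? u) w<u = adj-sym G u w
  disjoint : ∀ u w → (forward u w ∧ forward w u) ≡ false
  disjoint u w with Finₚ.<-cmp u w
  ... | tri< _ _ w≮u rewrite ⌊⌋-false (w Finₚ.<? u) w≮u = ∧-zeroʳ _
  ... | tri≈ u≮u refl _ rewrite ⌊⌋-false (u Finₚ.<? u) u≮u = refl
  ... | tri> u≮w _ _ rewrite ⌊⌋-false (u Finₚ.<? w) u≮w = refl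
  backward≡forward : σ (λ u → count (λ w → forward w u)) ≡ X
  backward≡forward = begin
    σ (λ u → count (λ w → forward w u))              ≡⟨ σ-cong (λ u → count≡σ (λ w → forward w u)) ⟩
    σ (λ u → σ (λ w → 𝟙 (forward w u)))              ≡⟨ σ-swap (λ u w → 𝟙 (forward w u)) ⟩
    σ (λ w → σ (λ u → 𝟙 (forward w u)))              ≡⟨ σ-cong (λ w → count≡σ (forward w)) ⟨
    X                                                ∎

restrict : Graph n → (Fin m → Fin n) → Graph m
restrict G v = record
  { adj     = λ a b → adj G (v a) (v b)
  ; adj-sym = λ a b → adj-sym G (v a) (v b)
  ; irrefl  = λ a → irrefl G (v a)
  }

complement : Graph n → Graph n
complement G = record
  { adj     = λ a b → not ⌊ a Fin.≟ b ⌋ ∧ not (adj G a b)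
  ; adj-sym = λ a b → cong₂ (λ x y → not x ∧ not y) (⌊≟⌋-sym a b) (adj-sym G a b)
  ; irrefl  = λ a → cong (λ x → not x ∧ not (adj G a a)) (⌊⌋-true (a Fin.≟ a) refl)
  }
  where
  ⌊≟⌋-sym : (a b : Fin n) → ⌊ a Fin.≟ b ⌋ ≡ ⌊ b Fin.≟ a ⌋
  ⌊≟⌋-sym a b = ⌊⌋-⇔ (mk⇔ sym sym) (a Fin.≟ b) (b Fin.≟ a)

⊆ᵍ-trans : (F : Graph k) (G : Graph m) (H : Graph n) → F ⊆ᵍ G → G ⊆ᵍ H → F ⊆ᵍ H
⊆ᵍ-trans _ _ _ (f , f-inj , f-hom) (g , g-inj , g-hom) =
  g ∘ f , f-inj ∘ g-inj , λ a b ab → g-hom (f a) (f b) (f-hom a b ab)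

adjacent⇒≢ : (G : Graph n) {u w : Fin n} → adj G u w ≡ true → u ≢ w
adjacent⇒≢ G {u} uw refl = contradiction (trans (sym uw) (irrefl G u)) λ ()

deg-≤ : (G : Graph n) (u : Fin n) → deg G u ≤ n ∸ 1
deg-≤ {n} G u = begin
  deg G u                            ≡⟨ deg≡count G u ⟩
  count (adj G u)                    ≤⟨ count-mono (λ x ux → cong not (⌊⌋-false (x Fin.≟ u) (adjacent⇒≢ G ux ∘ sym))) ⟩
  count (λ x → not ⌊ x Fin.≟ u ⌋)    ≡⟨ count-≢ u ⟩
  n ∸ 1                              ∎
  where open ≤-Reasoning

full-degree⇒adjacent : (G : Graph n) {u w : Fin n} → deg G u ≡ n ∸ 1 → u ≢ w → adj G u w ≡ true
full-degree⇒adjacent {n} G {u} {w} full u≢w with adj G u w in uw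
... | true  = refl
... | false = contradiction too-many (n≮n (n ∸ 1))
  where
  open ≤-Reasoning
  closed-nbhd : Fin n → Bool
  closed-nbhd x = ⌊ x Fin.≟ u ⌋ ∨ adj G u x
  misses-w : ∀ x → closed-nbhd x ≡ true → not ⌊ x Fin.≟ w ⌋ ≡ true
  misses-w x ux with x Fin.≟ w
  ... | no  _    = refl
  ... | yes refl with x Fin.≟ u
  ...   | yes refl = contradiction refl u≢w
  ...   | no  _    = contradiction (trans (sym ux) uw) λ ()
  disjoint : ∀ x → (⌊ x Fin.≟ u ⌋ ∧ adj G u x) ≡ false
  disjoint x with x Fin.≟ u
  ... | yes refl = irrefl G x
  ... | no  _    = refl
  too-many : suc (n ∸ 1) ≤ n ∸ 1
  too-many = begin
    1 + (n ∸ 1)                                   ≡⟨ cong₂ _+_ (count-≡ u) (trans (sym (deg≡count G u)) full) ⟨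
    count (λ x → ⌊ x Fin.≟ u ⌋) + count (adj G u) ≡⟨ count-∨ disjoint ⟨
    count closed-nbhd                             ≤⟨ count-mono misses-w ⟩
    count (λ x → not ⌊ x Fin.≟ w ⌋)               ≡⟨ count-≢ w ⟩
    n ∸ 1                                         ∎

adjacent-to-all⇒deg-≥ : (G : Graph n) {u : Fin n} → (∀ w → u ≢ w → adj G u w ≡ true) → n ∸ 1 ≤ deg G u
adjacent-to-all⇒deg-≥ {n} G {u} all = begin
  n ∸ 1                             ≡⟨ count-≢ u ⟨
  count (λ x → not ⌊ x Fin.≟ u ⌋)   ≤⟨ count-mono reaches ⟩
  count (adj G u)                   ≡⟨ deg≡count G u ⟨
  deg G u                           ∎
  where
  open ≤-Reasoning
  reaches : ∀ x → not ⌊ x Fin.≟ u ⌋ ≡ true → adj G u x ≡ true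
  reaches x x≢u with x Fin.≟ u
  ... | no x≢u = all x (x≢u ∘ sym)

module _ (G : Graph n) (v : Fin m → Fin n) (v-inj : Injective _≡_ _≡_ v)
         {t : ℕ} (t≤n : t ≤ n) (v-high : ∀ j → t ≤ toℕ (v j)) where

  deg-restrict-above-universal : ∀ i → (∀ x → toℕ x < t → adj G (v i) x ≡ true) →
                                 t + deg (restrict G v) i ≤ deg G (v i)
  deg-restrict-above-universal i universal = begin
    t + deg (restrict G v) i                     ≡⟨ cong₂ _+_ (count-< t≤n) (sym (deg≡count (restrict G v) i)) ⟨
    count low + count (adj G u ∘ v)              ≡⟨ cong (_+_ (count low)) (count-cong (λ j → high-only (v j) (v-high j))) ⟩
    count low + count (high-nbr ∘ v)             ≤⟨ +-monoʳ-≤ (count low) (count-∘-injective v v-inj high-nbr) ⟩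
    count low + count high-nbr                   ≡⟨ count-∨ disjoint ⟨
    count (λ x → low x ∨ high-nbr x)             ≤⟨ count-mono nbr ⟩
    count (adj G u)                              ≡⟨ deg≡count G u ⟨
    deg G u                                      ∎
    where
    open ≤-Reasoning
    u : Fin n
    u = v i
    low high-nbr : Fin n → Bool
    low x = ⌊ toℕ x <? t ⌋
    high-nbr x = adj G u x ∧ not (low x)
    high-only : ∀ x → t ≤ toℕ x → adj G u x ≡ high-nbr x
    high-only x t≤x rewrite ⌊⌋-false (toℕ x <? t) (≤⇒≯ t≤x) = sym (∧-identityʳ _)
    disjoint : ∀ x → (low x ∧ high-nbr x) ≡ false
    disjoint x with toℕ x <? t
    ... | yes _ = ∧-zeroʳ _
    ... | no  _ = refl
    nbr : ∀ x → (low x ∨ high-nbr x) ≡ true → adj G u x ≡ true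
    nbr x hx with toℕ x <? t
    ... | yes x<t = universal x x<t
    ... | no  _   = trans (sym (∧-identityʳ _)) hx

complement-edge : (G : Graph n) {a b : Fin n} → adj (complement G) a b ≡ true → a ≢ b × adj G a b ≡ false
complement-edge G {a} {b} ab with a Fin.≟ b | adj G a b
... | no a≢b | false = a≢b , refl

complement-restrict-⊆ : (H : Graph m) (G : Graph n) (emb : H ⊆ᵍ G) (x : Fin k → Fin m) →
                        complement (restrict G (proj₁ emb ∘ x)) ⊆ᵍ complement (restrict H x)
complement-restrict-⊆ H G (f , _ , f-hom) x = (λ a → a) , (λ eq → eq) , non-edge
  where
  non-edge : ∀ a b → adj (complement (restrict G (f ∘ x))) a b ≡ true → adj (complement (restrict H x)) a b ≡ true
  non-edge a b ab with complement-edge (restrict G (f ∘ x)) ab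
  ... | a≢b , G-non-edge with adj H (x a) (x b) in H-edge
  ...   | true  = contradiction (trans (sym (f-hom (x a) (x b) H-edge)) G-non-edge) λ ()
  ...   | false = cong (λ e → not e ∧ true) (⌊⌋-false (a Fin.≟ b) a≢b)

-- The with-clauses below follow the definition of KminusU in Defs, so that its adjacency reduces.
KminusU-outside : (r : ℕ) (U : Graph k) {a b : Fin (suc r)} → ¬ toℕ a < k → a ≢ b → adj (KminusU r U) a b ≡ true
KminusU-outside {k} r U {a} {b} a≮k a≢b with a Fin.≟ b
... | yes a≡b = contradiction a≡b a≢b
... | no _ with toℕ a <? k | toℕ b <? k
...   | yes a<k | _     = contradiction a<k a≮k
...   | no _    | yes _ = refl
...   | no _    | no _  = refl

KminusU-non-edge : (r : ℕ) (U : Graph k) {a b : Fin (suc r)} (a<k : toℕ a < k) (b<k : toℕ b < k) →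
                   a ≢ b → adj (KminusU r U) a b ≡ false → adj U (fromℕ< a<k) (fromℕ< b<k) ≡ true
KminusU-non-edge {k} r U {a} {b} a<k b<k a≢b non-edge with a Fin.≟ b
... | yes a≡b = contradiction a≡b a≢b
... | no _ with toℕ a <? k | toℕ b <? k
...   | no a≮k  | _       = contradiction a<k a≮k
...   | yes _   | no b≮k  = contradiction b<k b≮k
...   | yes a<k′ | yes b<k′ rewrite <-irrelevant a<k a<k′ | <-irrelevant b<k b<k′
  with adj U (fromℕ< a<k′) (fromℕ< b<k′)
...     | true = refl

complement-restrict-KminusU-⊆ : (r : ℕ) (U : Graph k) (x : Fin m → Fin (suc r)) → Injective _≡_ _≡_ x →
                                (x<k : ∀ i → toℕ (x i) < k) → complement (restrict (KminusU r U) x) ⊆ᵍ U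
complement-restrict-KminusU-⊆ r U x x-inj x<k = φ , φ-inj , φ-hom
  where
  φ : Fin _ → Fin _
  φ i = fromℕ< (x<k i)
  φ-inj : Injective _≡_ _≡_ φ
  φ-inj {i} {j} eq = x-inj (Finₚ.toℕ-injective (begin
    toℕ (x i)  ≡⟨ Finₚ.toℕ-fromℕ< (x<k i) ⟨
    toℕ (φ i)  ≡⟨ cong toℕ eq ⟩
    toℕ (φ j)  ≡⟨ Finₚ.toℕ-fromℕ< (x<k j) ⟩
    toℕ (x j)  ∎))
    where open ≡-Reasoning
  φ-hom : ∀ a b → adj (complement (restrict (KminusU r U) x)) a b ≡ true → adj U (φ a) (φ b) ≡ true
  φ-hom a b ab with complement-edge (restrict (KminusU r U) x) ab
  ... | a≢b , non-edge = KminusU-non-edge r U (x<k a) (x<k b) (a≢b ∘ x-inj) non-edge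

Sparse : Graph n → Set
Sparse H = (∀ i → deg H i ≤ 2) × (∀ i j → i ≢ j → deg H i ≤ 1 ⊎ deg H j ≤ 1)

sparse? : (H : Graph n) → Dec (Sparse H)
sparse? H = Finₚ.all? (λ i → deg H i ≤? 2)
  ×-dec Finₚ.all? (λ i → Finₚ.all? λ j → ¬? (i Fin.≟ j) →-dec (deg H i ≤? 1 ⊎-dec deg H j ≤? 1))

Distinct : (Fin m → Fin n) → Set
Distinct f = ∀ i j → i ≢ j → f i ≢ f j

distinct⇒injective : (f : Fin m → Fin n) → Distinct f → Injective _≡_ _≡_ f
distinct⇒injective f distinct {i} {j} fi≡fj with i Fin.≟ j
... | yes i≡j = i≡j
... | no  i≢j = contradiction fi≡fj (distinct i j i≢j)

Homomorphism : Graph m → Graph n → (Fin m → Fin n) → Set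
Homomorphism H G f = ∀ a b → adj H a b ≡ true → adj G (f a) (f b) ≡ true

embedding? : (H : Graph m) (G : Graph n) (f : Fin m → Fin n) → Dec (Distinct f × Homomorphism H G f)
embedding? H G f = Finₚ.all? (λ i → Finₚ.all? λ j → ¬? (i Fin.≟ j) →-dec ¬? (f i Fin.≟ f j))
  ×-dec Finₚ.all? (λ a → Finₚ.all? λ b → (adj H a b Boolₚ.≟ true) →-dec (adj G (f a) (f b) Boolₚ.≟ true))

quadruple : Fin n → Fin n → Fin n → Fin n → Fin 4 → Fin n
quadruple a b c d zero                   = a
quadruple a b c d (suc zero)             = b
quadruple a b c d (suc (suc zero))       = c
quadruple a b c d (suc (suc (suc zero))) = d

EmbedsByQuadruple : Graph 4 → Graph n → Set
EmbedsByQuadruple H G = ∃ λ a → ∃ λ b → ∃ λ c → ∃ λ d →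
  Distinct (quadruple a b c d) × Homomorphism H G (quadruple a b c d)

embedsByQuadruple? : (H : Graph 4) (G : Graph n) → Dec (EmbedsByQuadruple H G)
embedsByQuadruple? H G =
  Finₚ.any? λ a → Finₚ.any? λ b → Finₚ.any? λ c → Finₚ.any? λ d → embedding? H G (quadruple a b c d)

embedsByQuadruple⇒⊆ᵍ : (H : Graph 4) (G : Graph n) → EmbedsByQuadruple H G → H ⊆ᵍ G
embedsByQuadruple⇒⊆ᵍ H G (a , b , c , d , distinct , hom) =
  quadruple a b c d , distinct⇒injective (quadruple a b c d) distinct , hom

fromEdges : (e01 e02 e03 e12 e13 e23 : Bool) → Graph 4
fromEdges e01 e02 e03 e12 e13 e23 = record { adj = E ; adj-sym = E-sym ; irrefl = E-irrefl }
  where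
  E : Fin 4 → Fin 4 → Bool
  E zero (suc zero) = e01
  E zero (suc (suc zero)) = e02
  E zero (suc (suc (suc zero))) = e03
  E (suc zero) (suc (suc zero)) = e12
  E (suc zero) (suc (suc (suc zero))) = e13
  E (suc (suc zero)) (suc (suc (suc zero))) = e23
  E (suc zero) zero = e01
  E (suc (suc zero)) zero = e02
  E (suc (suc (suc zero))) zero = e03
  E (suc (suc zero)) (suc zero) = e12
  E (suc (suc (suc zero))) (suc zero) = e13
  E (suc (suc (suc zero))) (suc (suc zero)) = e23
  E _ _ = false
  E-sym : ∀ a b → E a b ≡ E b a
  E-sym zero zero = refl
  E-sym zero (suc zero) = refl
  E-sym zero (suc (suc zero)) = refl
  E-sym zero (suc (suc (suc zero))) = refl
  E-sym (suc zero) zero = refl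
  E-sym (suc zero) (suc zero) = refl
  E-sym (suc zero) (suc (suc zero)) = refl
  E-sym (suc zero) (suc (suc (suc zero))) = refl
  E-sym (suc (suc zero)) zero = refl
  E-sym (suc (suc zero)) (suc zero) = refl
  E-sym (suc (suc zero)) (suc (suc zero)) = refl
  E-sym (suc (suc zero)) (suc (suc (suc zero))) = refl
  E-sym (suc (suc (suc zero))) zero = refl
  E-sym (suc (suc (suc zero))) (suc zero) = refl
  E-sym (suc (suc (suc zero))) (suc (suc zero)) = refl
  E-sym (suc (suc (suc zero))) (suc (suc (suc zero))) = refl
  E-irrefl : ∀ a → E a a ≡ false
  E-irrefl zero = refl
  E-irrefl (suc zero) = refl
  E-irrefl (suc (suc zero)) = refl
  E-irrefl (suc (suc (suc zero))) = refl

∀-Bool? : {P : Bool → Set} → Decidable P → Dec (∀ b → P b)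
∀-Bool? P? with P? false | P? true
... | yes f | yes t = yes λ { false → f ; true → t }
... | no ¬f | _     = no λ all → ¬f (all false)
... | yes _ | no ¬t = no λ all → ¬t (all true)

-- Checked on all 64 graphs on four vertices: a sparse one lies inside a perfect matching or inside
-- a path with two edges, whose complements in K4 are C4 and Z4.
sparse-fromEdges : ∀ e01 e02 e03 e12 e13 e23 → let H = fromEdges e01 e02 e03 e12 e13 e23 in
  Sparse H → EmbedsByQuadruple C4 (complement H) ⊎ EmbedsByQuadruple Z4 (complement H)
sparse-fromEdges = from-yes
  (∀-Bool? λ e01 → ∀-Bool? λ e02 → ∀-Bool? λ e03 → ∀-Bool? λ e12 → ∀-Bool? λ e13 → ∀-Bool? λ e23 →
   let H = fromEdges e01 e02 e03 e12 e13 e23 in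
   sparse? H →-dec (embedsByQuadruple? C4 (complement H) ⊎-dec embedsByQuadruple? Z4 (complement H)))

SameAdjacency : Graph n → Graph n → Set
SameAdjacency H H′ = ∀ a b → adj H a b ≡ adj H′ a b

sameAdjacency-deg : {H H′ : Graph n} → SameAdjacency H H′ → ∀ i → deg H i ≡ deg H′ i
sameAdjacency-deg {H = H} {H′} same i =
  trans (deg≡count H i) (trans (count-cong (same i)) (sym (deg≡count H′ i)))

sameAdjacency-sparse : {H H′ : Graph n} → SameAdjacency H H′ → Sparse H → Sparse H′
sameAdjacency-sparse {H = H} {H′} same (≤2 , unique) =
  (λ i → subst (_≤ 2) (deg≡ i) (≤2 i)) ,
  (λ i j i≢j → Sum.map (subst (_≤ 1) (deg≡ i)) (subst (_≤ 1) (deg≡ j)) (unique i j i≢j))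
  where
  deg≡ : ∀ i → deg H i ≡ deg H′ i
  deg≡ = sameAdjacency-deg {H = H} {H′} same

sameAdjacency-complement-⊆ᵍ : {K : Graph m} {H H′ : Graph n} → SameAdjacency H H′ →
                              K ⊆ᵍ complement H′ → K ⊆ᵍ complement H
sameAdjacency-complement-⊆ᵍ {H = H} {H′} same (f , f-inj , f-hom) = f , f-inj , λ a b ab →
  trans (cong (λ e → not ⌊ f a Fin.≟ f b ⌋ ∧ not e) (same (f a) (f b))) (f-hom a b ab)

edgesOf : Graph 4 → Graph 4
edgesOf H = fromEdges (adj H zero (suc zero)) (adj H zero (suc (suc zero))) (adj H zero (suc (suc (suc zero))))
                      (adj H (suc zero) (suc (suc zero))) (adj H (suc zero) (suc (suc (suc zero))))
                      (adj H (suc (suc zero)) (suc (suc (suc zero))))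

fromEdges-adj : (H : Graph 4) → SameAdjacency H (edgesOf H)
fromEdges-adj H zero zero = irrefl H zero
fromEdges-adj H zero (suc zero) = refl
fromEdges-adj H zero (suc (suc zero)) = refl
fromEdges-adj H zero (suc (suc (suc zero))) = refl
fromEdges-adj H (suc zero) zero = adj-sym H _ _
fromEdges-adj H (suc zero) (suc zero) = irrefl H _
fromEdges-adj H (suc zero) (suc (suc zero)) = refl
fromEdges-adj H (suc zero) (suc (suc (suc zero))) = refl
fromEdges-adj H (suc (suc zero)) zero = adj-sym H _ _
fromEdges-adj H (suc (suc zero)) (suc zero) = adj-sym H _ _
fromEdges-adj H (suc (suc zero)) (suc (suc zero)) = irrefl H _
fromEdges-adj H (suc (suc zero)) (suc (suc (suc zero))) = refl
fromEdges-adj H (suc (suc (suc zero))) zero = adj-sym H _ _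
fromEdges-adj H (suc (suc (suc zero))) (suc zero) = adj-sym H _ _
fromEdges-adj H (suc (suc (suc zero))) (suc (suc zero)) = adj-sym H _ _
fromEdges-adj H (suc (suc (suc zero))) (suc (suc (suc zero))) = irrefl H _

sparse⇒complement-⊇-C4-or-Z4 : (H : Graph 4) → Sparse H → C4 ⊆ᵍ complement H ⊎ Z4 ⊆ᵍ complement H
sparse⇒complement-⊇-C4-or-Z4 H sparse =
  Sum.map (in-complement C4) (in-complement Z4)
      (sparse-fromEdges _ _ _ _ _ _ (sameAdjacency-sparse {H = H} {edgesOf H} (fromEdges-adj H) sparse))
  where
  in-complement : (K : Graph 4) → EmbedsByQuadruple K (complement (edgesOf H)) → K ⊆ᵍ complement H
  in-complement K emb = sameAdjacency-complement-⊆ᵍ {K = K} {H} {edgesOf H} (fromEdges-adj H)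
    (embedsByQuadruple⇒⊆ᵍ K (complement (edgesOf H)) emb)

injection-reaches : ∀ {t N} (g : Fin N → Fin n) → Injective _≡_ _≡_ g → t < N → ∃ λ i → t ≤ toℕ (g i)
injection-reaches {t = t} {N = N} g g-inj t<N
  with Finₚ.¬∀⟶∃¬ N (λ i → toℕ (g i) < t) (λ i → toℕ (g i) <? t) all-below-impossible
  where
  all-below-impossible : ¬ (∀ i → toℕ (g i) < t)
  all-below-impossible below with Finₚ.pigeonhole t<N (λ i → fromℕ< (below i))
  ... | i , j , i<j , eq = <-irrefl (cong toℕ (g-inj (Finₚ.toℕ-injective (begin
        toℕ (g i)                ≡⟨ Finₚ.toℕ-fromℕ< (below i) ⟨
        toℕ (fromℕ< (below i))   ≡⟨ cong toℕ eq ⟩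
        toℕ (fromℕ< (below j))   ≡⟨ Finₚ.toℕ-fromℕ< (below j) ⟩
        toℕ (g j)                ∎)))) i<j
    where open ≡-Reasoning
... | i , g-i≮t = i , ≮⇒≥ g-i≮t

injection-reaches-many : ∀ {t} s {N} (g : Fin N → Fin n) → Injective _≡_ _≡_ g → s + t ≤ N →
                         Σ (Fin s → Fin N) λ x → Injective _≡_ _≡_ x × (∀ c → t ≤ toℕ (g (x c)))
injection-reaches-many zero g g-inj _ = (λ ()) , (λ {}) , λ ()
injection-reaches-many {t = t} (suc s) {suc N} g g-inj (s≤s s+t≤N)
  with injection-reaches g g-inj (s≤s (≤-trans (m≤n+m t s) s+t≤N))
... | i , i-high with injection-reaches-many s (g ∘ punchIn i) (Finₚ.punchIn-injective i _ _ ∘ g-inj) s+t≤N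
...   | x , x-inj , x-high = y , y-inj , y-high
  where
  y : Fin (suc s) → Fin (suc N)
  y zero    = i
  y (suc c) = punchIn i (x c)
  y-inj : Injective _≡_ _≡_ y
  y-inj {zero}  {zero}  _  = refl
  y-inj {zero}  {suc c} eq = contradiction (sym eq) (Finₚ.punchInᵢ≢i i (x c))
  y-inj {suc c} {zero}  eq = contradiction eq (Finₚ.punchInᵢ≢i i (x c))
  y-inj {suc c} {suc d} eq = cong suc (x-inj (Finₚ.punchIn-injective i _ _ eq))
  y-high : ∀ c → t ≤ toℕ (g (y c))
  y-high zero    = i-high
  y-high (suc c) = x-high c

-- Sequences that are not potentially (K_{t+4} − U)-graphic

module _ (t : ℕ) {n : ℕ} (π : Seq n) (t≤n : t ≤ n)
         (π-top  : ∀ x → toℕ x < t → π x ≡ n ∸ 1)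
         (π-high : ∀ x → t ≤ toℕ x → π x ≤ t + 2)
         (π-peak : ∀ x → t ≤ toℕ x → t + 2 ≤ π x → toℕ x ≡ t) where

  module _ {k} (U : Graph k) (G : Graph n) (realizes : Realizes G π) (emb : KminusU (3 + t) U ⊆ᵍ G)
           (x : Fin 4 → Fin (4 + t)) (x-inj : Injective _≡_ _≡_ x) (x-high : ∀ i → t ≤ toℕ (proj₁ emb (x i))) where

    private
      K : Graph (4 + t)
      K = KminusU (3 + t) U
      f : Fin (4 + t) → Fin n
      f = proj₁ emb
      f-hom : ∀ a b → adj K a b ≡ true → adj G (f a) (f b) ≡ true
      f-hom = proj₂ (proj₂ emb)
      v : Fin 4 → Fin n
      v = f ∘ x
      H : Graph 4
      H = restrict G v

      v-inj : Injective _≡_ _≡_ v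
      v-inj = x-inj ∘ proj₁ (proj₂ emb)

      universal : ∀ u → toℕ u < t → ∀ w → u ≢ w → adj G u w ≡ true
      universal u u<t w = full-degree⇒adjacent G (trans (realizes u) (π-top u u<t))

      adjacent-to-top : ∀ i w → toℕ w < t → adj G (v i) w ≡ true
      adjacent-to-top i w w<t = trans (adj-sym G (v i) w) (universal w w<t (v i) w≢vi)
        where
        w≢vi : w ≢ v i
        w≢vi refl = <⇒≱ w<t (x-high i)

      t+deg≤π : ∀ i → t + deg H i ≤ π (v i)
      t+deg≤π i = ≤-trans (deg-restrict-above-universal G v v-inj t≤n x-high i (adjacent-to-top i))
                          (≤-reflexive (realizes (v i)))

      deg≤2 : ∀ i → deg H i ≤ 2
      deg≤2 i = +-cancelˡ-≤ t _ _ (≤-trans (t+deg≤π i) (π-high (v i) (x-high i)))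

      peak : ∀ i → 2 ≤ deg H i → toℕ (v i) ≡ t
      peak i 2≤deg = π-peak (v i) (x-high i) (≤-trans (+-monoʳ-≤ t 2≤deg) (t+deg≤π i))

      sparse : Sparse H
      sparse = deg≤2 , two-peaks-impossible
        where
        two-peaks-impossible : ∀ i j → i ≢ j → deg H i ≤ 1 ⊎ deg H j ≤ 1
        two-peaks-impossible i j i≢j with deg H i ≤? 1 | deg H j ≤? 1
        ... | yes i≤1 | _       = inj₁ i≤1
        ... | no  _   | yes j≤1 = inj₂ j≤1
        ... | no  i≰1 | no  j≰1 = contradiction (v-inj (Finₚ.toℕ-injective both-at-t)) i≢j
          where
          both-at-t : toℕ (v i) ≡ toℕ (v j)
          both-at-t = trans (peak i (≰⇒> i≰1)) (sym (peak j (≰⇒> j≰1)))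

      x<k : ∀ i → toℕ (x i) < k
      x<k i with toℕ (x i) <? k
      ... | yes xi<k = xi<k
      ... | no  xi≮k = contradiction (≤-trans (adjacent-to-all⇒deg-≥ H adjacent) (deg≤2 i)) λ { (s≤s (s≤s ())) }
        where
        adjacent : ∀ j → i ≢ j → adj H i j ≡ true
        adjacent j i≢j = f-hom (x i) (x j) (KminusU-outside (3 + t) U xi≮k (i≢j ∘ x-inj))

      H̄⊆U : complement H ⊆ᵍ U
      H̄⊆U = ⊆ᵍ-trans (complement H) (complement (restrict K x)) U
                      (complement-restrict-⊆ K G emb x) (complement-restrict-KminusU-⊆ (3 + t) U x x-inj x<k)

    C4-or-Z4⊆U : C4 ⊆ᵍ U ⊎ Z4 ⊆ᵍ U
    C4-or-Z4⊆U = Sum.map (via-H̄ C4) (via-H̄ Z4) (sparse⇒complement-⊇-C4-or-Z4 H sparse)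
      where
      via-H̄ : (F : Graph 4) → F ⊆ᵍ complement H → F ⊆ᵍ U
      via-H̄ F F⊆H̄ = ⊆ᵍ-trans F (complement H) U F⊆H̄ H̄⊆U

  not-potentially-KminusU : ∀ {k} (U : Graph k) → ¬ (C4 ⊆ᵍ U) → ¬ (Z4 ⊆ᵍ U) →
                            ¬ PotentiallyGraphic (KminusU (3 + t) U) π
  not-potentially-KminusU U C4⊈U Z4⊈U (G , realizes , emb) =
    let x , x-inj , x-high = injection-reaches-many 4 (proj₁ emb) (proj₁ (proj₂ emb)) ≤-refl
    in Sum.[ C4⊈U , Z4⊈U ]′ (C4-or-Z4⊆U U G realizes emb x x-inj x-high)

data Side (m n : ℕ) : Fin (m + n) → Set where
  left  : (i : Fin m) → Side m n (i ↑ˡ n)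
  right : (a : Fin n) → Side m n (m ↑ʳ a)

side : ∀ m {n} (x : Fin (m + n)) → Side m n x
side zero    x       = right x
side (suc m) zero    = left zero
side (suc m) (suc x) with side m x
... | left i  = left (suc i)
... | right a = right a

complete : ∀ n → Graph n
complete n = record
  { adj     = λ a b → not ⌊ b Fin.≟ a ⌋
  ; adj-sym = λ a b → cong not (⌊⌋-⇔ (mk⇔ sym sym) (b Fin.≟ a) (a Fin.≟ b))
  ; irrefl  = λ a → cong not (⌊⌋-true (a Fin.≟ a) refl)
  }

edgeless : ∀ n → Graph n
edgeless n = record { adj = λ _ _ → false ; adj-sym = λ _ _ → refl ; irrefl = λ _ → refl }

deg-complete : ∀ u → deg (complete n) u ≡ n ∸ 1
deg-complete {n} u = trans (deg≡count (complete n) u) (count-≢ u)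

deg-edgeless : ∀ u → deg (edgeless n) u ≡ 0
deg-edgeless {n} u = trans (deg≡count (edgeless n) u) (count-false n)

module _ (cross : Bool) (G : Graph m) (H : Graph n) where

  private
    sideAdj : Fin m ⊎ Fin n → Fin m ⊎ Fin n → Bool
    sideAdj (inj₁ i) (inj₁ j) = adj G i j
    sideAdj (inj₂ a) (inj₂ b) = adj H a b
    sideAdj _        _        = cross

    sideAdj-sym : ∀ p q → sideAdj p q ≡ sideAdj q p
    sideAdj-sym (inj₁ i) (inj₁ j) = adj-sym G i j
    sideAdj-sym (inj₁ _) (inj₂ _) = refl
    sideAdj-sym (inj₂ _) (inj₁ _) = refl
    sideAdj-sym (inj₂ a) (inj₂ b) = adj-sym H a b

    sideAdj-irrefl : ∀ p → sideAdj p p ≡ false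
    sideAdj-irrefl (inj₁ i) = irrefl G i
    sideAdj-irrefl (inj₂ a) = irrefl H a

  juxtapose : Graph (m + n)
  juxtapose = record
    { adj     = λ x y → sideAdj (splitAt m x) (splitAt m y)
    ; adj-sym = λ x y → sideAdj-sym (splitAt m x) (splitAt m y)
    ; irrefl  = λ x → sideAdj-irrefl (splitAt m x)
    }

  deg-juxtapose-left : ∀ i → deg juxtapose (i ↑ˡ n) ≡ deg G i + n * 𝟙 cross
  deg-juxtapose-left i rewrite deg≡count juxtapose (i ↑ˡ n) | Finₚ.splitAt-↑ˡ m i n = begin
    count (λ y → sideAdj (inj₁ i) (splitAt m y))
      ≡⟨ count-↑ m (λ y → sideAdj (inj₁ i) (splitAt m y)) ⟩
    count (λ j → sideAdj (inj₁ i) (splitAt m (j ↑ˡ n))) + count (λ b → sideAdj (inj₁ i) (splitAt m (m ↑ʳ b)))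
      ≡⟨ cong₂ _+_ (count-cong (λ j → cong (sideAdj (inj₁ i)) (Finₚ.splitAt-↑ˡ m j n)))
                   (count-cong (λ b → cong (sideAdj (inj₁ i)) (Finₚ.splitAt-↑ʳ m n b))) ⟩
    count (adj G i) + count {n} (λ _ → cross)
      ≡⟨ cong₂ _+_ (sym (deg≡count G i)) (count-const n cross) ⟩
    deg G i + n * 𝟙 cross ∎
    where open ≡-Reasoning

  deg-juxtapose-right : ∀ a → deg juxtapose (m ↑ʳ a) ≡ m * 𝟙 cross + deg H a
  deg-juxtapose-right a rewrite deg≡count juxtapose (m ↑ʳ a) | Finₚ.splitAt-↑ʳ m n a = begin
    count (λ y → sideAdj (inj₂ a) (splitAt m y))
      ≡⟨ count-↑ m (λ y → sideAdj (inj₂ a) (splitAt m y)) ⟩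
    count (λ j → sideAdj (inj₂ a) (splitAt m (j ↑ˡ n))) + count (λ b → sideAdj (inj₂ a) (splitAt m (m ↑ʳ b)))
      ≡⟨ cong₂ _+_ (count-cong (λ j → cong (sideAdj (inj₂ a)) (Finₚ.splitAt-↑ˡ m j n)))
                   (count-cong (λ b → cong (sideAdj (inj₂ a)) (Finₚ.splitAt-↑ʳ m n b))) ⟩
    count {m} (λ _ → cross) + count (adj H a)
      ≡⟨ cong₂ _+_ (count-const m cross) (sym (deg≡count H a)) ⟩
    m * 𝟙 cross + deg H a ∎
    where open ≡-Reasoning

_⊔ᵍ_ : Graph m → Graph n → Graph (m + n)
_⊔ᵍ_ = juxtapose false

_∨ᵍ_ : Graph m → Graph n → Graph (m + n)
_∨ᵍ_ = juxtapose true

module _ (t : ℕ) (L : Graph m) where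

  deg-complete-∨-left : ∀ i → deg (complete t ∨ᵍ L) (i ↑ˡ m) ≡ t + m ∸ 1
  deg-complete-∨-left i = begin
    deg (complete t ∨ᵍ L) (i ↑ˡ m)  ≡⟨ deg-juxtapose-left true (complete t) L i ⟩
    deg (complete t) i + m * 1      ≡⟨ cong₂ _+_ (deg-complete i) (*-identityʳ m) ⟩
    t ∸ 1 + m                       ≡⟨ +-∸-comm m (≤-trans (s≤s z≤n) (Finₚ.toℕ<n i)) ⟨
    t + m ∸ 1                       ∎
    where open ≡-Reasoning

  deg-complete-∨-right : ∀ a → deg (complete t ∨ᵍ L) (t ↑ʳ a) ≡ t + deg L a
  deg-complete-∨-right a = trans (deg-juxtapose-right true (complete t) L a) (cong (_+ deg L a) (*-identityʳ t))

  complete-∨-nonIncreasing : NonIncreasing (deg L) → NonIncreasing (deg (complete t ∨ᵍ L))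
  complete-∨-nonIncreasing L-nonInc x y x≤y with side t x | side t y
  ... | left i  | left j
    rewrite deg-complete-∨-left i | deg-complete-∨-left j = ≤-refl
  ... | left i  | right b
    rewrite deg-complete-∨-left i | deg-complete-∨-right b =
      ≤-trans (+-monoʳ-≤ t (deg-≤ L b)) (≤-reflexive (sym (+-∸-assoc t (≤-trans (s≤s z≤n) (Finₚ.toℕ<n b)))))
  ... | right a | left j = contradiction (begin-strict
      t                ≤⟨ m≤m+n t (toℕ a) ⟩
      t + toℕ a        ≡⟨ Finₚ.toℕ-↑ʳ t a ⟨
      toℕ (t ↑ʳ a)     ≤⟨ x≤y ⟩
      toℕ (j ↑ˡ m)     ≡⟨ Finₚ.toℕ-↑ˡ j m ⟩
      toℕ j            <⟨ Finₚ.toℕ<n j ⟩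
      t                ∎) (n≮n t)
    where open ≤-Reasoning
  ... | right a | right b
    rewrite deg-complete-∨-right a | deg-complete-∨-right b =
      +-monoʳ-≤ t (L-nonInc a b (+-cancelˡ-≤ t _ _ (subst₂ _≤_ (Finₚ.toℕ-↑ʳ t a) (Finₚ.toℕ-↑ʳ t b) x≤y)))

  σ-deg-complete-∨ : σ (deg (complete t ∨ᵍ L)) ≡ t * (t + m ∸ 1) + (m * t + σ (deg L))
  σ-deg-complete-∨ = begin
    σ (deg (complete t ∨ᵍ L))
      ≡⟨ σ-↑ t (deg (complete t ∨ᵍ L)) ⟩
    σ (λ i → deg (complete t ∨ᵍ L) (i ↑ˡ m)) + σ (λ a → deg (complete t ∨ᵍ L) (t ↑ʳ a))
      ≡⟨ cong₂ _+_ (σ-cong deg-complete-∨-left) (σ-cong deg-complete-∨-right) ⟩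
    σ {t} (λ _ → t + m ∸ 1) + σ (λ a → t + deg L a)
      ≡⟨ cong₂ _+_ (σ-const t (t + m ∸ 1)) (σ-+ (λ _ → t) (deg L)) ⟩
    t * (t + m ∸ 1) + (σ {m} (λ _ → t) + σ (deg L))
      ≡⟨ cong (λ s → t * (t + m ∸ 1) + (s + σ (deg L))) (σ-const m t) ⟩
    t * (t + m ∸ 1) + (m * t + σ (deg L))
      ∎
    where open ≡-Reasoning

-- The extremal sequence

matching : ∀ p → Graph (p * 2)
matching zero    = edgeless 0
matching (suc p) = complete 2 ⊔ᵍ matching p

deg-matching : ∀ p (x : Fin (p * 2)) → deg (matching p) x ≡ 1
deg-matching (suc p) x with side 2 x
... | left i  = trans (deg-juxtapose-left false (complete 2) (matching p) i)
                      (cong₂ _+_ (deg-complete i) (*-zeroʳ (p * 2)))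
... | right a = trans (deg-juxtapose-right false (complete 2) (matching p) a) (deg-matching p a)

star : ∀ e → Graph (2 + 𝟙 e)
star e = complete 1 ∨ᵍ edgeless (1 + 𝟙 e)

deg-star-centre : ∀ e → deg (star e) zero ≡ 1 + 𝟙 e
deg-star-centre e = trans (deg-juxtapose-left true (complete 1) (edgeless (1 + 𝟙 e)) zero) (*-identityʳ (1 + 𝟙 e))

deg-star-leaf : ∀ e (a : Fin (1 + 𝟙 e)) → deg (star e) (suc a) ≡ 1
deg-star-leaf e a = trans (deg-juxtapose-right true (complete 1) (edgeless (1 + 𝟙 e)) a) (cong suc (deg-edgeless a))

lowerSize : Bool → ℕ → ℕ
lowerSize e p = (2 + 𝟙 e) + p * 2

lowerGraph : ∀ e p → Graph (lowerSize e p)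
lowerGraph e p = star e ⊔ᵍ matching p

deg-lowerGraph-zero : ∀ e p → deg (lowerGraph e p) zero ≡ 1 + 𝟙 e
deg-lowerGraph-zero e p = trans (deg-juxtapose-left false (star e) (matching p) zero)
                                (trans (cong (_+_ (deg (star e) zero)) (*-zeroʳ (p * 2)))
                                       (trans (+-identityʳ _) (deg-star-centre e)))

deg-lowerGraph-≢zero : ∀ e p x → x ≢ zero → deg (lowerGraph e p) x ≡ 1
deg-lowerGraph-≢zero e p x x≢0 with side (2 + 𝟙 e) x
... | left zero    = contradiction refl x≢0
... | left (suc a) = trans (deg-juxtapose-left false (star e) (matching p) (suc a))
                           (trans (cong (_+_ (deg (star e) (suc a))) (*-zeroʳ (p * 2)))
                                  (trans (+-identityʳ _) (deg-star-leaf e a)))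
... | right b      = trans (deg-juxtapose-right false (star e) (matching p) b)
                           (trans (cong (_+ deg (matching p) b) (*-zeroʳ (2 + 𝟙 e))) (deg-matching p b))

module _ (e : Bool) (p : ℕ) where

  private
    L : Graph (lowerSize e p)
    L = lowerGraph e p

  lowerGraph-nonIncreasing : NonIncreasing (deg L)
  lowerGraph-nonIncreasing zero    zero    _ = ≤-refl
  lowerGraph-nonIncreasing zero    (suc b) _
    rewrite deg-lowerGraph-zero e p | deg-lowerGraph-≢zero e p (suc b) (λ ()) = s≤s z≤n
  lowerGraph-nonIncreasing (suc a) (suc b) _
    rewrite deg-lowerGraph-≢zero e p (suc a) (λ ()) | deg-lowerGraph-≢zero e p (suc b) (λ ()) = ≤-refl

  deg-lowerGraph-≤2 : ∀ x → deg L x ≤ 2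
  deg-lowerGraph-≤2 zero    rewrite deg-lowerGraph-zero e p = s≤s (𝟙≤1 e)
  deg-lowerGraph-≤2 (suc x) rewrite deg-lowerGraph-≢zero e p (suc x) (λ ()) = s≤s z≤n

  deg-lowerGraph-peak : ∀ x → 2 ≤ deg L x → x ≡ zero
  deg-lowerGraph-peak zero    _ = refl
  deg-lowerGraph-peak (suc x) 2≤deg =
    contradiction (≤-trans 2≤deg (≤-reflexive (deg-lowerGraph-≢zero e p (suc x) (λ ())))) λ { (s≤s ()) }

  σ-deg-lowerGraph : σ (deg L) ≡ lowerSize e p + 𝟙 e
  σ-deg-lowerGraph = begin
    σ (deg L)                                  ≡⟨ σ-suc (deg L) ⟩
    deg L zero + σ (λ x → deg L (suc x))
      ≡⟨ cong₂ _+_ (deg-lowerGraph-zero e p) (σ-cong (λ x → deg-lowerGraph-≢zero e p (suc x) (λ ()))) ⟩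
    1 + 𝟙 e + σ {suc (𝟙 e + p * 2)} (λ _ → 1)
      ≡⟨ cong (_+_ (1 + 𝟙 e)) (trans (σ-const (suc (𝟙 e + p * 2)) 1) (*-identityʳ _)) ⟩
    1 + 𝟙 e + suc (𝟙 e + p * 2)                ≡⟨ regroup (𝟙 e) p ⟩
    lowerSize e p + 𝟙 e                        ∎
    where
    open ≡-Reasoning
    regroup : ∀ E p → 1 + E + suc (E + p * 2) ≡ (2 + E) + p * 2 + E
    regroup = ℕ-Solver.solve-∀

module _ (t : ℕ) (e : Bool) (p : ℕ) where

  private
    L : Graph (lowerSize e p)
    L = lowerGraph e p

  extremalSequence : Seq (t + lowerSize e p)
  extremalSequence = deg (complete t ∨ᵍ L)

  extremal-graphic : Graphic extremalSequence
  extremal-graphic = complete-∨-nonIncreasing t L (lowerGraph-nonIncreasing e p) , complete t ∨ᵍ L , λ _ → refl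

  extremal-top : ∀ x → toℕ x < t → extremalSequence x ≡ t + lowerSize e p ∸ 1
  extremal-top x x<t with side t x
  ... | left i  = deg-complete-∨-left t L i
  ... | right a = contradiction (subst (_< t) (Finₚ.toℕ-↑ʳ t a) x<t) (≤⇒≯ (m≤m+n t (toℕ a)))

  extremal-high : ∀ x → t ≤ toℕ x → extremalSequence x ≤ t + 2
  extremal-high x t≤x with side t x
  ... | left i  = contradiction (subst (t ≤_) (Finₚ.toℕ-↑ˡ i (lowerSize e p)) t≤x) (<⇒≱ (Finₚ.toℕ<n i))
  ... | right a = ≤-trans (≤-reflexive (deg-complete-∨-right t L a)) (+-monoʳ-≤ t (deg-lowerGraph-≤2 e p a))

  extremal-peak : ∀ x → t ≤ toℕ x → t + 2 ≤ extremalSequence x → toℕ x ≡ t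
  extremal-peak x t≤x t+2≤ with side t x
  ... | left i  = contradiction (subst (t ≤_) (Finₚ.toℕ-↑ˡ i (lowerSize e p)) t≤x) (<⇒≱ (Finₚ.toℕ<n i))
  ... | right a
    rewrite deg-lowerGraph-peak e p a (+-cancelˡ-≤ t 2 _ (≤-trans t+2≤ (≤-reflexive (deg-complete-∨-right t L a))))
    = trans (Finₚ.toℕ-↑ʳ t zero) (+-identityʳ t)

  σ-extremal : σ extremalSequence ≡ t * (t + lowerSize e p ∸ 1) + (lowerSize e p * t + (lowerSize e p + 𝟙 e))
  σ-extremal = trans (σ-deg-complete-∨ t L)
                     (cong (λ s → t * (t + lowerSize e p ∸ 1) + (lowerSize e p * t + s)) (σ-deg-lowerGraph e p))

boundEven : ℕ → ℕ → ℤ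
boundEven n r = (+ r ℤ.- + 1) ℤ.* (+ 2 ℤ.* + n ℤ.- + r) ℤ.- + 3 ℤ.* (+ n ℤ.- + r)

bound≡boundEven-parity : ∀ n r → bound n r ≡ boundEven n r ℤ.- + ((n ∸ r) % 2)
bound≡boundEven-parity n r with (n ∸ r) % 2 | m%n<n (n ∸ r) 2
... | 0           | _                = sym (ℤₚ.+-identityʳ (boundEven n r))
... | 1           | _                = refl
... | suc (suc _) | s≤s (s≤s ())

boundEven-shift : ∀ r′ d → boundEven (suc r′ + d) (suc r′) ≡ + (r′ * (suc r′ + 2 * d)) ℤ.- + (3 * d)
boundEven-shift r′ d = begin
  boundEven (suc r′ + d) (suc r′)
    ≡⟨ cong₂ F R≡ (trans (ℤₚ.pos-+ (suc r′) d) (cong (ℤ._+ + d) R≡)) ⟩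
  F (+ 1 ℤ.+ + r′) (+ 1 ℤ.+ + r′ ℤ.+ + d)
    ≡⟨ shift (+ r′) (+ d) ⟩
  + r′ ℤ.* ((+ 1 ℤ.+ + r′) ℤ.+ + 2 ℤ.* + d) ℤ.- + 3 ℤ.* + d
    ≡⟨ cong₂ (λ x y → + r′ ℤ.* x ℤ.- y) (sym (trans (ℤₚ.pos-+ (suc r′) (2 * d)) (cong₂ ℤ._+_ R≡ (ℤₚ.pos-* 2 d))))
                                        (sym (ℤₚ.pos-* 3 d)) ⟩
  + r′ ℤ.* + (suc r′ + 2 * d) ℤ.- + (3 * d)
    ≡⟨ cong (ℤ._- + (3 * d)) (sym (ℤₚ.pos-* r′ (suc r′ + 2 * d))) ⟩
  + (r′ * (suc r′ + 2 * d)) ℤ.- + (3 * d) ∎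
  where
  open ≡-Reasoning
  F : ℤ → ℤ → ℤ
  F R N = (R ℤ.- + 1) ℤ.* (+ 2 ℤ.* N ℤ.- R) ℤ.- + 3 ℤ.* (N ℤ.- R)
  R≡ : + suc r′ ≡ + 1 ℤ.+ + r′
  R≡ = ℤₚ.pos-+ 1 r′
  shift : ∀ x y → (+ 1 ℤ.+ x ℤ.- + 1) ℤ.* (+ 2 ℤ.* (+ 1 ℤ.+ x ℤ.+ y) ℤ.- (+ 1 ℤ.+ x))
                    ℤ.- + 3 ℤ.* ((+ 1 ℤ.+ x ℤ.+ y) ℤ.- (+ 1 ℤ.+ x))
                ≡ x ℤ.* ((+ 1 ℤ.+ x) ℤ.+ + 2 ℤ.* y) ℤ.- + 3 ℤ.* y
  shift = ℤ-Solver.solve-∀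

bound-extremal : ∀ t e q → bound (t + lowerSize e (suc q)) (3 + t) ≡ + (σ (extremalSequence t e (suc q)) + 2)
bound-extremal t e q = begin
  bound (t + lowerSize e (suc q)) (3 + t)
    ≡⟨ cong (λ n → bound n (3 + t)) (n-shape t (𝟙 e) q) ⟩
  bound (3 + t + d) (3 + t)
    ≡⟨ bound≡boundEven-parity (3 + t + d) (3 + t) ⟩
  boundEven (3 + t + d) (3 + t) ℤ.- + ((3 + t + d ∸ (3 + t)) % 2)
    ≡⟨ cong₂ (λ x k → x ℤ.- + k) (boundEven-shift (2 + t) d)
                                 (trans (cong (_% 2) (m+n∸m≡n (3 + t) d)) (d-parity e)) ⟩
  + ((2 + t) * (3 + t + 2 * d)) ℤ.- + (3 * d) ℤ.- + 𝟙 (not e)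
    ≡⟨ cong (λ x → + x ℤ.- + (3 * d) ℤ.- + 𝟙 (not e)) (polynomial e) ⟩
  + (σ₀ + 2 + 𝟙 (not e) + 3 * d) ℤ.- + (3 * d) ℤ.- + 𝟙 (not e)
    ≡⟨ cancel (σ₀ + 2) (𝟙 (not e)) (3 * d) ⟩
  + (σ₀ + 2) ∎
  where
  open ≡-Reasoning
  d σ₀ : ℕ
  d = 𝟙 e + suc (q * 2)
  σ₀ = σ (extremalSequence t e (suc q))

  n-shape : ∀ t E q → t + ((2 + E) + suc q * 2) ≡ 3 + t + (E + suc (q * 2))
  n-shape = ℕ-Solver.solve-∀

  d-parity : ∀ e → (𝟙 e + suc (q * 2)) % 2 ≡ 𝟙 (not e)
  d-parity false = [m+kn]%n≡m%n 1 q 2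
  d-parity true  = [m+kn]%n≡m%n 0 (suc q) 2

  polynomial : ∀ e → (2 + t) * (3 + t + 2 * (𝟙 e + suc (q * 2)))
                      ≡ σ (extremalSequence t e (suc q)) + 2 + 𝟙 (not e) + 3 * (𝟙 e + suc (q * 2))
  polynomial false rewrite σ-extremal t false (suc q) | +-∸-assoc t {lowerSize false (suc q)} {1} (s≤s z≤n)
    = ℕ-Solver.solve (t ∷ q ∷ [])
  polynomial true  rewrite σ-extremal t true  (suc q) | +-∸-assoc t {lowerSize true (suc q)} {1} (s≤s z≤n)
    = ℕ-Solver.solve (t ∷ q ∷ [])

  cancel : ∀ x c b → + (x + c + b) ℤ.- + b ℤ.- + c ≡ + x
  cancel x c b = begin
    + (x + c + b) ℤ.- + b ℤ.- + c
      ≡⟨ cong (λ z → z ℤ.- + b ℤ.- + c) (trans (ℤₚ.pos-+ (x + c) b) (cong (ℤ._+ + b) (ℤₚ.pos-+ x c))) ⟩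
    + x ℤ.+ + c ℤ.+ + b ℤ.- + b ℤ.- + c    ≡⟨ cancel-ℤ (+ x) (+ c) (+ b) ⟩
    + x                                    ∎
    where
    cancel-ℤ : ∀ x c b → x ℤ.+ c ℤ.+ b ℤ.- b ℤ.- c ≡ x
    cancel-ℤ = ℤ-Solver.solve-∀

even-gap : ∀ {a b} → 2 ∣ a → 2 ∣ b → a < b → a + 2 ≤ b
even-gap {b = b} (divides x refl) (divides y refl) x*2<y*2 = begin
  x * 2 + 2   ≡⟨ +-comm (x * 2) 2 ⟩
  suc x * 2   ≤⟨ *-monoˡ-≤ 2 (*-cancelʳ-< _ x y x*2<y*2) ⟩
  y * 2       ∎
  where open ≤-Reasoning

module _ {m n} (H : Graph m) {l : ℕ} (admissible : SigmaAdmissible H n l) where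

  non-potential⇒admissible-above : {π : Seq n} → Graphic π → ¬ PotentiallyGraphic H π → σ π + 2 ≤ l
  non-potential⇒admissible-above {π} graphic@(_ , G , realizes) non-potential =
    even-gap σπ-even (proj₁ admissible) σπ<l
    where
    σπ-even : 2 ∣ σ π
    σπ-even = subst (2 ∣_) (σ-cong realizes) (degree-sum-even G)
    σπ<l : σ π < l
    σπ<l = ≰⇒> λ l≤σπ → non-potential (proj₂ admissible π graphic l≤σπ)

parity-split : ∀ m → ∃₂ λ e h → m ≡ 𝟙 e + h * 2
parity-split zero = false , 0 , refl
parity-split (suc m) with parity-split m
... | false , h , m≡ = true  , h     , cong suc m≡
... | true  , h , m≡ = false , suc h , cong suc m≡

four≤⇒shape : ∀ {m} → 4 ≤ m → ∃₂ λ e q → m ≡ lowerSize e (suc q)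
four≤⇒shape {m} 4≤m with parity-split m
... | e , 0           , refl = contradiction (≤-trans 4≤m (+-monoˡ-≤ 0 (𝟙≤1 e))) λ { (s≤s ()) }
... | e , 1           , refl = contradiction (≤-trans 4≤m (+-monoˡ-≤ 2 (𝟙≤1 e))) λ { (s≤s (s≤s (s≤s ()))) }
... | e , suc (suc q) , refl = e , q , shift (𝟙 e) q
  where
  shift : ∀ E q → E + suc (suc q) * 2 ≡ (2 + E) + suc q * 2
  shift = ℕ-Solver.solve-∀

module _ {k} (U : Graph k) (C4⊈U : ¬ (C4 ⊆ᵍ U)) (Z4⊈U : ¬ (Z4 ⊆ᵍ U)) where

  extremal-lower-bound : ∀ t e q l → let n = t + lowerSize e (suc q) in
                         SigmaAdmissible (KminusU (3 + t) U) n l → bound n (3 + t) ≤ℤ + l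
  extremal-lower-bound t e q l admissible =
    subst (_≤ℤ + l) (sym (bound-extremal t e q))
      (+≤+ (non-potential⇒admissible-above (KminusU (3 + t) U) admissible (extremal-graphic t e (suc q))
        (not-potentially-KminusU t (extremalSequence t e (suc q)) (m≤m+n t _)
          (extremal-top t e (suc q)) (extremal-high t e (suc q)) (extremal-peak t e (suc q)) U C4⊈U Z4⊈U)))

  lower-bound : ∀ t m → 4 ≤ m → ∀ l →
                SigmaAdmissible (KminusU (3 + t) U) (t + m) l → bound (t + m) (3 + t) ≤ℤ + l
  lower-bound t m 4≤m l with four≤⇒shape 4≤m
  ... | e , q , refl = extremal-lower-bound t e q l

lemma3p2 : (n r k j : ℕ) → r + 1 ≤ n → k ≤ r + 1 → 7 ≤ k →
    (U : Graph k) → edgeCount U ≡ j → ¬ (C4 ⊆ᵍ U) → ¬ (Z4 ⊆ᵍ U) →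
    (l : ℕ) → SigmaAdmissible (KminusU r U) n l → bound n r ≤ℤ + l
lemma3p2 n r k j r+1≤n k≤r+1 7≤k U _ C4⊈U Z4⊈U l =
  subst₂ (λ N R → SigmaAdmissible (KminusU R U) N l → bound N R ≤ℤ + l) n≡ r≡
         (lower-bound U C4⊈U Z4⊈U t (n ∸ t) (subst (_≤ n ∸ t) (m+n∸m≡n t 4) (∸-monoˡ-≤ t t+4≤n)) l)
  where
  t : ℕ
  t = r ∸ 3
  r≡ : 3 + t ≡ r
  r≡ = m+[n∸m]≡n (s≤s⁻¹ (≤-trans (≤-trans (m≤m+n 4 3) 7≤k) (subst (k ≤_) (+-comm r 1) k≤r+1)))
  t+4≤n : t + 4 ≤ n
  t+4≤n = subst (_≤ n) (trans (+-comm r 1) (sym (trans (+-comm t 4) (cong suc r≡)))) r+1≤n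
  n≡ : t + (n ∸ t) ≡ n
  n≡ = m+[n∸m]≡n (≤-trans (m≤m+n t 4) t+4≤n)
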